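{- Let $G$ be a finite simple graph with girth at least $7$. Suppose there is a path $s_1u_1vu_2s_2$ in $G$ such that $s_1$ and $s_2$ are support vertices and, for each $i\in\{1,2\}$, $u_i$ is the only neighbor of $s_i$ that has degree at least $2$. Then $G$ has two maximal open packings of different cardinalities.
   Context: A set $P$ of vertices is an open packing if no two distinct vertices of $P$ have a common neighbor; a maximal open packing is one maximal under inclusion. A support vertex is a vertex adjacent to at least one vertex of degree $1$. The girth is the length of a shortest cycle ($\infty$ if acyclic). -}

module Defs where

open import Data.Nat using (ℕ; zero; suc; _≤_)
open import Data.Bool using (Bool; true; false)
open import Data.Fin using (Fin; zero; suc; inject₁; fromℕ)
open import Data.Fin.Subset using (Subset; _∈_; _∉_; ∣_∣; _∪_; ⁅_⁆)
open import Data.Vec using (tabulate)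
open import Data.Product using (Σ; _×_; _,_; ∃)
open import Function.Definitions using (Injective)
open import Relation.Binary.PropositionalEquality using (_≡_; _≢_)
open import Relation.Nullary using (¬_)
open import Data.Empty using (⊥)

record Graph (n : ℕ) : Set where
  field
    adj     : Fin n → Fin n → Bool
    adj-sym : ∀ u v → adj u v ≡ adj v u
    irrefl  : ∀ v → adj v v ≡ false

module _ {n : ℕ} (G : Graph n) where
  open Graph G

  Adj : Fin n → Fin n → Set
  Adj u v = adj u v ≡ true

  N : Fin n → Subset n
  N v = tabulate (adj v)

  degree : Fin n → ℕ
  degree v = ∣ N v ∣

  Support : Fin n → Set
  Support s = ∃ λ l → Adj s l × degree l ≡ 1

  CycleOfLength : ℕ → Set
  CycleOfLength zero = ⊥
  CycleOfLength (suc m) =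
    Σ (Fin (suc m) → Fin n) λ f →
      Injective _≡_ _≡_ f ×
      (∀ (i : Fin m) → Adj (f (inject₁ i)) (f (suc i))) ×
      Adj (f (fromℕ m)) (f zero)

  GirthAtLeast7 : Set
  GirthAtLeast7 = ∀ k → 3 ≤ k → k ≤ 6 → ¬ CycleOfLength k

  OpenPacking : Subset n → Set
  OpenPacking P = ∀ x y w → x ∈ P → y ∈ P → x ≢ y → Adj x w → Adj y w → ⊥

  MaximalOpenPacking : Subset n → Set
  MaximalOpenPacking P =
    OpenPacking P × (∀ v → v ∉ P → ¬ OpenPacking (P ∪ ⁅ v ⁆))

module Submission where

-- Let Q be any maximal open packing containing v.  Since s₁ and
-- v share the neighbour u₁ (and s₂, v share u₂), neither s₁ nor s₂ lies in Q.
-- Exchange v for the two support vertices: P₀ = (Q - v) ∪ {s₁} ∪ {s₂}.  A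
-- common neighbour w of sᵢ and any other vertex has degree ≥ 2, so w = uᵢ,
-- the only such neighbour of sᵢ.  Hence a vertex of Q - v sharing a
-- neighbour with sᵢ would share uᵢ with v, and s₁, s₂ sharing a neighbour
-- would force u₁ = u₂; so P₀ is an open packing with |P₀| = |Q| + 1.
-- Extending P₀ to a maximal open packing P gives |P| > |Q|.

open import Defs
open import Data.Nat using (ℕ; _≥_; zero; suc; _≤_; _+_; _<_)
open import Data.Nat.Properties
  using (≤-trans; <-≤-trans; <⇒≢; <⇒≱; +-suc; +-monoʳ-≤; m≤m+n; module ≤-Reasoning)
open import Data.Fin using (Fin; zero; suc)
open import Data.Fin.Properties using (any?; all?) renaming (_≟_ to _≟F_)
open import Data.Fin.Subset
  using (Subset; ∣_∣; _∈_; _∉_; _⊆_; _∪_; ⁅_⁆; _-_; inside; outside)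
open import Data.Fin.Subset.Properties
  using ( _∈?_; x∈p∪q⁻; x∈p∪q⁺; x∈⁅x⁆; x∈⁅y⁆⇒x≡y; p⊆p∪q; p─q⊆p
        ; p─⊥≡p; p⊂q⇒∣p∣<∣q∣; p⊆q⇒∣p∣≤∣q∣; ∣p∣≤n; ∣⁅x⁆∣≡1)
open import Data.Vec using (_∷_; tabulate; here; there)
open import Data.Vec.Properties using (lookup⇒[]=; lookup∘tabulate)
open import Data.Bool using (true) renaming (_≟_ to _≟B_)
open import Data.Product using (Σ; _×_; ∃₂; _,_; proj₁)
open import Data.Sum using (inj₁; inj₂)
open import Data.Empty using (⊥; ⊥-elim)
open import Function using (_∘_)
open import Relation.Nullary using (¬_; Dec; yes; no; ¬?)
open import Relation.Nullary.Decidable using (_→-dec_; _×-dec_)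
open import Relation.Binary.PropositionalEquality
  using (_≡_; _≢_; refl; sym; trans; cong; subst)

∣p∣<∣p∪⁅x⁆∣ : ∀ {n} {p : Subset n} {x : Fin n} → x ∉ p → ∣ p ∣ < ∣ p ∪ ⁅ x ⁆ ∣
∣p∣<∣p∪⁅x⁆∣ {x = x} x∉p = p⊂q⇒∣p∣<∣q∣ (p⊆p∪q _ , x , x∈p∪q⁺ (inj₂ (x∈⁅x⁆ x)) , x∉p)

∣p∣≡1+∣p-x∣ : ∀ {n} (p : Subset n) (x : Fin n) → x ∈ p → ∣ p ∣ ≡ suc ∣ p - x ∣
∣p∣≡1+∣p-x∣ (inside ∷ p) zero    here      = cong (suc ∘ ∣_∣) (sym (p─⊥≡p p))
∣p∣≡1+∣p-x∣ (outside ∷ p) (suc x) (there m) = ∣p∣≡1+∣p-x∣ p x m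
∣p∣≡1+∣p-x∣ (inside ∷ p)  (suc x) (there m) = cong suc (∣p∣≡1+∣p-x∣ p x m)

two-members⇒2≤∣p∣ : ∀ {n} {p : Subset n} {x y : Fin n} →
                    x ∈ p → y ∈ p → x ≢ y → 2 ≤ ∣ p ∣
two-members⇒2≤∣p∣ {p = p} {x} {y} x∈p y∈p x≢y =
  subst (_< ∣ p ∣) (∣⁅x⁆∣≡1 x)
    (p⊂q⇒∣p∣<∣q∣ (⁅x⁆⊆p , y , y∈p , x≢y ∘ sym ∘ x∈⁅y⁆⇒x≡y x))
  where
  ⁅x⁆⊆p : ⁅ x ⁆ ⊆ p
  ⁅x⁆⊆p z∈⁅x⁆ = subst (_∈ p) (sym (x∈⁅y⁆⇒x≡y x z∈⁅x⁆)) x∈p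

x∉p-x : ∀ {n} (p : Subset n) (x : Fin n) → x ∉ p - x
x∉p-x (b ∷ p) zero    ()
x∉p-x (b ∷ p) (suc x) (there m) = x∉p-x p x m

x∈p-y⇒x≢y : ∀ {n} {p : Subset n} {x y : Fin n} → x ∈ p - y → x ≢ y
x∈p-y⇒x≢y {p = p} {x} x∈p-y refl = x∉p-x p x x∈p-y

-- The recursion adds an
-- element while possible; the size bound n ≤ k + ∣ P ∣ limits it to k steps.
module MaximalExtension {n : ℕ} {Φ : Subset n → Set} (Φ? : ∀ P → Dec (Φ P)) where

  Maximal : Subset n → Set
  Maximal M = Φ M × (∀ v → v ∉ M → ¬ Φ (M ∪ ⁅ v ⁆))

  extendWithin : (k : ℕ) (P : Subset n) → Φ P → n ≤ k + ∣ P ∣ →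
                 Σ (Subset n) λ M → P ⊆ M × Maximal M
  extendWithin k P φP bound with any? (λ v → ¬? (v ∈? P) ×-dec Φ? (P ∪ ⁅ v ⁆))
  ... | no stuck = P , (λ x∈P → x∈P) , φP , λ v v∉P φ → stuck (v , v∉P , φ)
  ... | yes (v , v∉P , φP′) with k
  ...   | zero = ⊥-elim (<⇒≱ (∣p∣<∣p∪⁅x⁆∣ v∉P) (≤-trans (∣p∣≤n (P ∪ ⁅ v ⁆)) bound))
  ...   | suc k′ with extendWithin k′ (P ∪ ⁅ v ⁆) φP′ bound′
    where
    bound′ : n ≤ k′ + ∣ P ∪ ⁅ v ⁆ ∣
    bound′ = ≤-trans bound (subst (_≤ k′ + ∣ P ∪ ⁅ v ⁆ ∣) (+-suc k′ ∣ P ∣)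
                                  (+-monoʳ-≤ k′ (∣p∣<∣p∪⁅x⁆∣ v∉P)))
  ...     | M , P∪v⊆M , maxM = M , P∪v⊆M ∘ p⊆p∪q _ , maxM

  extendToMaximal : (P : Subset n) → Φ P → Σ (Subset n) λ M → P ⊆ M × Maximal M
  extendToMaximal P φP = extendWithin n P φP (m≤m+n n ∣ P ∣)

module _ {n : ℕ} (G : Graph n) where
  open Graph G

  adj-symmetric : ∀ {x y} → Adj G x y → Adj G y x
  adj-symmetric {x} {y} x~y = trans (adj-sym y x) x~y

  Adj? : ∀ x y → Dec (Adj G x y)
  Adj? x y = adj x y ≟B true

  neighbour∈N : ∀ {w x} → Adj G w x → x ∈ N G w
  neighbour∈N {w} {x} w~x =
    lookup⇒[]= x (tabulate (adj w)) (trans (lookup∘tabulate (adj w) x) w~x)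

  openPacking? : (P : Subset n) → Dec (OpenPacking G P)
  openPacking? P = all? λ x → all? λ y → all? λ w →
    (x ∈? P) →-dec ((y ∈? P) →-dec (¬? (x ≟F y) →-dec
      (Adj? x w →-dec (Adj? y w →-dec no (λ ())))))

  extendToMaximalOpenPacking : (P : Subset n) → OpenPacking G P →
    Σ (Subset n) λ M → P ⊆ M × MaximalOpenPacking G M
  extendToMaximalOpenPacking = MaximalExtension.extendToMaximal openPacking?

  singleton-openPacking : ∀ v → OpenPacking G ⁅ v ⁆
  singleton-openPacking v x y w x∈ y∈ x≢y _ _ =
    x≢y (trans (x∈⁅y⁆⇒x≡y v x∈) (sym (x∈⁅y⁆⇒x≡y v y∈)))

  openPacking-⊆ : ∀ {P Q} → P ⊆ Q → OpenPacking G Q → OpenPacking G P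
  openPacking-⊆ P⊆Q opQ x y w x∈ y∈ = opQ x y w (P⊆Q x∈) (P⊆Q y∈)

  openPacking-∪⁅⁆ : ∀ {P} s → OpenPacking G P →
    (∀ x w → x ∈ P → x ≢ s → Adj G x w → Adj G s w → ⊥) →
    OpenPacking G (P ∪ ⁅ s ⁆)
  openPacking-∪⁅⁆ {P} s opP noShared x y w x∈ y∈ x≢y x~w y~w
    with x∈p∪q⁻ P ⁅ s ⁆ x∈ | x∈p∪q⁻ P ⁅ s ⁆ y∈
  ... | inj₁ x∈P | inj₁ y∈P = opP x y w x∈P y∈P x≢y x~w y~w
  ... | inj₁ x∈P | inj₂ y∈s rewrite x∈⁅y⁆⇒x≡y s y∈s = noShared x w x∈P x≢y x~w y~w
  ... | inj₂ x∈s | inj₁ y∈P rewrite x∈⁅y⁆⇒x≡y s x∈s = noShared y w y∈P (x≢y ∘ sym) y~w x~w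
  ... | inj₂ x∈s | inj₂ y∈s = x≢y (trans (x∈⁅y⁆⇒x≡y s x∈s) (sym (x∈⁅y⁆⇒x≡y s y∈s)))

  sharedNeighbour⇒∉ : ∀ {Q x y w} → OpenPacking G Q → y ∈ Q → x ≢ y →
                      Adj G x w → Adj G y w → x ∉ Q
  sharedNeighbour⇒∉ opQ y∈Q x≢y x~w y~w x∈Q = opQ _ _ _ x∈Q y∈Q x≢y x~w y~w

  -- If u is the only neighbour of s of degree ≥ 2, then every common
  -- neighbour of s and another vertex y is u (it has degree ≥ 2).
  forcedCommonNeighbour : ∀ {s u} → (∀ w → Adj G s w → degree G w ≥ 2 → w ≡ u) →
    ∀ {y w} → y ≢ s → Adj G s w → Adj G y w → w ≡ u
  forcedCommonNeighbour unique {w = w} y≢s s~w y~w =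
    unique w s~w (two-members⇒2≤∣p∣ (neighbour∈N (adj-symmetric s~w))
                                    (neighbour∈N (adj-symmetric y~w)) (y≢s ∘ sym))

  module Exchange {Q : Subset n} {v : Fin n} (opQ : OpenPacking G Q) (v∈Q : v ∈ Q)
                  {s u : Fin n} (s≢v : s ≢ v) (s~u : Adj G s u) (v~u : Adj G v u)
                  (unique : ∀ w → Adj G s w → degree G w ≥ 2 → w ≡ u) where

    s∉Q : s ∉ Q
    s∉Q = sharedNeighbour⇒∉ opQ v∈Q s≢v s~u v~u

    noSharedWithQ-v : ∀ x w → x ∈ Q - v → x ≢ s → Adj G x w → Adj G s w → ⊥
    noSharedWithQ-v x w x∈Q-v x≢s x~w s~w with forcedCommonNeighbour unique x≢s s~w x~w
    ... | refl = opQ x v u (p─q⊆p Q ⁅ v ⁆ x∈Q-v) v∈Q (x∈p-y⇒x≢y x∈Q-v) x~w v~u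

  exchange : ∀ {Q v s₁ u₁ s₂ u₂} → OpenPacking G Q → v ∈ Q →
    s₁ ≢ v → s₂ ≢ v → s₁ ≢ s₂ → u₁ ≢ u₂ →
    Adj G s₁ u₁ → Adj G v u₁ → Adj G s₂ u₂ → Adj G v u₂ →
    (∀ w → Adj G s₁ w → degree G w ≥ 2 → w ≡ u₁) →
    (∀ w → Adj G s₂ w → degree G w ≥ 2 → w ≡ u₂) →
    OpenPacking G (((Q - v) ∪ ⁅ s₁ ⁆) ∪ ⁅ s₂ ⁆) ×
    ∣ Q ∣ < ∣ ((Q - v) ∪ ⁅ s₁ ⁆) ∪ ⁅ s₂ ⁆ ∣
  exchange {Q} {v} {s₁} {u₁} {s₂} {u₂} opQ v∈Q s₁≢v s₂≢v s₁≢s₂ u₁≢u₂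
           s₁~u₁ v~u₁ s₂~u₂ v~u₂ unique₁ unique₂ =
    openPacking-∪⁅⁆ s₂ opP₁ noSharedWithP₁ , size
    where
    module E₁ = Exchange opQ v∈Q s₁≢v s₁~u₁ v~u₁ unique₁
    module E₂ = Exchange opQ v∈Q s₂≢v s₂~u₂ v~u₂ unique₂

    P₁ : Subset n
    P₁ = (Q - v) ∪ ⁅ s₁ ⁆

    opP₁ : OpenPacking G P₁
    opP₁ = openPacking-∪⁅⁆ s₁ (openPacking-⊆ (p─q⊆p Q ⁅ v ⁆) opQ) E₁.noSharedWithQ-v

    -- s₂ shares no neighbour with Q - v (exchange step) nor with s₁ (a
    -- common neighbour would equal both u₁ and u₂).
    noSharedWithP₁ : ∀ x w → x ∈ P₁ → x ≢ s₂ → Adj G x w → Adj G s₂ w → ⊥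
    noSharedWithP₁ x w x∈P₁ x≢s₂ x~w s₂~w with x∈p∪q⁻ (Q - v) ⁅ s₁ ⁆ x∈P₁
    ... | inj₁ x∈Q-v = E₂.noSharedWithQ-v x w x∈Q-v x≢s₂ x~w s₂~w
    ... | inj₂ x∈s₁ rewrite x∈⁅y⁆⇒x≡y s₁ x∈s₁ =
      u₁≢u₂ (trans (sym (forcedCommonNeighbour unique₁ (s₁≢s₂ ∘ sym) x~w s₂~w))
                   (forcedCommonNeighbour unique₂ s₁≢s₂ s₂~w x~w))

    s₁∉Q-v : s₁ ∉ Q - v
    s₁∉Q-v = E₁.s∉Q ∘ p─q⊆p Q ⁅ v ⁆

    s₂∉P₁ : s₂ ∉ P₁
    s₂∉P₁ s₂∈P₁ with x∈p∪q⁻ (Q - v) ⁅ s₁ ⁆ s₂∈P₁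
    ... | inj₁ s₂∈Q-v = E₂.s∉Q (p─q⊆p Q ⁅ v ⁆ s₂∈Q-v)
    ... | inj₂ s₂∈s₁  = s₁≢s₂ (sym (x∈⁅y⁆⇒x≡y s₁ s₂∈s₁))

    size : ∣ Q ∣ < ∣ P₁ ∪ ⁅ s₂ ⁆ ∣
    size = begin-strict
      ∣ Q ∣             ≡⟨ ∣p∣≡1+∣p-x∣ Q v v∈Q ⟩
      suc ∣ Q - v ∣     ≤⟨ ∣p∣<∣p∪⁅x⁆∣ s₁∉Q-v ⟩
      ∣ P₁ ∣            <⟨ ∣p∣<∣p∪⁅x⁆∣ s₂∉P₁ ⟩
      ∣ P₁ ∪ ⁅ s₂ ⁆ ∣   ∎
      where open ≤-Reasoning

lemma4 : ∀ {n} (G : Graph n) → GirthAtLeast7 G →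
    (s₁ u₁ v u₂ s₂ : Fin n) →
    s₁ ≢ u₁ → s₁ ≢ v → s₁ ≢ u₂ → s₁ ≢ s₂ → u₁ ≢ v → u₁ ≢ u₂ → u₁ ≢ s₂ →
    v ≢ u₂ → v ≢ s₂ → u₂ ≢ s₂ →
    Adj G s₁ u₁ → Adj G u₁ v → Adj G v u₂ → Adj G u₂ s₂ →
    Support G s₁ → Support G s₂ →
    (∀ w → Adj G s₁ w → degree G w ≥ 2 → w ≡ u₁) →
    (∀ w → Adj G s₂ w → degree G w ≥ 2 → w ≡ u₂) →
    ∃₂ λ (P Q : Subset n) →
    MaximalOpenPacking G P × MaximalOpenPacking G Q × ∣ P ∣ ≢ ∣ Q ∣
lemma4 G _ s₁ u₁ v u₂ s₂ _ s₁≢v _ s₁≢s₂ _ u₁≢u₂ _ _ v≢s₂ _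
       s₁~u₁ u₁~v v~u₂ u₂~s₂ _ _ unique₁ unique₂
  with extendToMaximalOpenPacking G ⁅ v ⁆ (singleton-openPacking G v)
... | Q , ⁅v⁆⊆Q , maxQ
  with exchange G (proj₁ maxQ) (⁅v⁆⊆Q (x∈⁅x⁆ v)) s₁≢v (v≢s₂ ∘ sym) s₁≢s₂ u₁≢u₂
         s₁~u₁ (adj-symmetric G u₁~v) (adj-symmetric G u₂~s₂) v~u₂ unique₁ unique₂
... | opP₀ , ∣Q∣<∣P₀∣
  with extendToMaximalOpenPacking G _ opP₀
... | P , P₀⊆P , maxP =
  P , Q , maxP , maxQ ,
  λ ∣P∣≡∣Q∣ → <⇒≢ (<-≤-trans ∣Q∣<∣P₀∣ (p⊆q⇒∣p∣≤∣q∣ P₀⊆P)) (sym ∣P∣≡∣Q∣)
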